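{- Let $G$ and $H$ be finite simple graphs with $G\in\mathfrak{F}$. Then $\gamma_R(G\boxtimes H)\ge \gamma(G)\gamma_R(H)$.
   Context: $\gamma(X)$ denotes the domination number of a graph $X$ (minimum size of a set $D$ such that every vertex outside $D$ has a neighbor in $D$). A Roman dominating function on $X$ is a map $f:V(X)\to\{0,1,2\}$ such that every vertex $v$ with $f(v)=0$ has a neighbor $u$ with $f(u)=2$; $\gamma_R(X)$ is the minimum of $\sum_v f(v)$ over such $f$. $\mathfrak{F}$ is the class of graphs $G$ having a dominating set $S=\{u_1,\dots,u_{\gamma(G)}\}$ of size $\gamma(G)$ with $N[u_i]\cap N[u_j]=\emptyset$ for all $i\ne j$, where $N[u]$ is the closed neighborhood of $u$. The strong product $G\boxtimes H$ has vertex set $V(G)\times V(H)$, with distinct $(g,h),(g',h')$ adjacent iff ($g=g'$ and $h\sim h'$) or ($g\sim g'$ and $h=h'$) or ($g\sim g'$ and $h\sim h'$). -}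

module Defs where

open import Data.Nat using (ℕ; zero; suc; _+_; _*_; _≤_)
open import Data.Fin using (Fin; toℕ; remQuot)
open import Data.Fin.Subset using (Subset; _∈_; _∉_; ∣_∣)
open import Data.Product using (Σ; ∃; ∃-syntax; _×_; _,_; proj₁; proj₂)
open import Data.Sum using (_⊎_)
open import Data.Empty using (⊥)
open import Relation.Nullary using (¬_)
open import Relation.Binary.PropositionalEquality using (_≡_; refl; sym)
open import Data.Sum using (inj₁; inj₂)

record Graph : Set₁ where
  field
    n      : ℕ
    Adj    : Fin n → Fin n → Set
    adj-sym : ∀ {u v} → Adj u v → Adj v u
    irrefl : ∀ {u} → ¬ Adj u u
open Graph public

InClosedNbhd : (G : Graph) → Fin (n G) → Fin (n G) → Set
InClosedNbhd G u w = w ≡ u ⊎ Adj G u w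

IsDominating : (G : Graph) → Subset (n G) → Set
IsDominating G D = ∀ v → v ∉ D → ∃[ u ] (u ∈ D × Adj G v u)

IsDominationNumber : (G : Graph) → ℕ → Set
IsDominationNumber G k =
  (∃[ D ] (IsDominating G D × ∣ D ∣ ≡ k)) ×
  (∀ D → IsDominating G D → k ≤ ∣ D ∣)

total : ∀ {m} → (Fin m → ℕ) → ℕ
total {zero}  f = 0
total {suc m} f = f Fin.zero + total (λ i → f (Fin.suc i))

IsRomanDominating : (G : Graph) → (Fin (n G) → Fin 3) → Set
IsRomanDominating G f =
  ∀ v → toℕ (f v) ≡ 0 → ∃[ u ] (Adj G v u × toℕ (f u) ≡ 2)

weight : (G : Graph) → (Fin (n G) → Fin 3) → ℕ
weight G f = total (λ v → toℕ (f v))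

IsRomanDominationNumber : (G : Graph) → ℕ → Set
IsRomanDominationNumber G k =
  (∃[ f ] (IsRomanDominating G f × weight G f ≡ k)) ×
  (∀ f → IsRomanDominating G f → k ≤ weight G f)

InF : Graph → Set
InF G = ∃[ S ] (IsDominating G S × IsDominationNumber G ∣ S ∣ ×
          (∀ u v → u ∈ S → v ∈ S → ¬ (u ≡ v) →
             ∀ w → InClosedNbhd G u w → ¬ InClosedNbhd G v w))

-- Strong product on Fin (n G * n H); vertex i corresponds to the pair remQuot i.
StrongAdj : (G H : Graph) → Fin (n G * n H) → Fin (n G * n H) → Set
StrongAdj G H x y with remQuot {n G} (n H) x | remQuot {n G} (n H) y
... | g , h | g' , h' =
  ¬ (g ≡ g' × h ≡ h') ×
  ((g ≡ g' ⊎ Adj G g g') × (h ≡ h' ⊎ Adj H h h'))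

private
  symE : ∀ (K : Graph) {a b : Fin (n K)} → (a ≡ b ⊎ Adj K a b) → (b ≡ a ⊎ Adj K b a)
  symE K (inj₁ e) = inj₁ (sym e)
  symE K (inj₂ p) = inj₂ (adj-sym K p)

StrongAdj-sym : (G H : Graph) → ∀ {x y} → StrongAdj G H x y → StrongAdj G H y x
StrongAdj-sym G H {x} {y} p with remQuot {n G} (n H) x | remQuot {n G} (n H) y
... | g , h | g' , h' with p
... | ne , a , b = (λ { (e1 , e2) → ne (sym e1 , sym e2) }) , symE G a , symE H b

StrongAdj-irrefl : (G H : Graph) → ∀ {x} → ¬ StrongAdj G H x x
StrongAdj-irrefl G H {x} p with remQuot {n G} (n H) x
... | g , h with p
... | ne , _ = ne (refl , refl)

_⊠_ : Graph → Graph → Graph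
G ⊠ H = record
  { n = n G * n H
  ; Adj = StrongAdj G H
  ; adj-sym = StrongAdj-sym G H
  ; irrefl = StrongAdj-irrefl G H
  }

-- Let F be a minimum Roman dominating function of G ⊠ H and S the packing of
-- closed neighbourhoods given by G ∈ 𝔉. For u ∈ S, summing F over the column
-- N[u] × {h} and capping at 2 yields a Roman dominating function of H: if
-- (u , h) has value 0, its F-neighbour (g' , h') of value 2 has g' ∈ N[u], and
-- h' ≠ h since the column at h sums to 0. That function weighs at most F on
-- N[u] × V(H); as the N[u] are disjoint, |S| γ_R(H) ≤ w(F), and |S| ≥ γ(G).

module Submission where

open import Defs
import Algebra.Properties.CommutativeMonoid.Sum as CommutativeMonoidSum
open import Data.Fin using (Fin; zero; suc; toℕ; combine; remQuot; _↑ˡ_; _↑ʳ_; _≟_)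
open import Data.Fin.Properties using (suc-injective; ∀-cons; remQuot-combine; combine-remQuot)
open import Data.Fin.Subset using (Subset; _∈_; ∣_∣; inside; outside)
open import Data.Fin.Subset.Properties using (_∈?_)
open import Data.Nat using (ℕ; zero; suc; _+_; _*_; _≤_; z≤n; s≤s; _≤?_)
open import Data.Nat.Properties
  using (+-0-commutativeMonoid; +-assoc; +-identityʳ; +-mono-≤; *-monoˡ-≤; m≤m+n; m≤n+m; n≤0⇒n≡0; ≤-reflexive; ≤-trans; module ≤-Reasoning)
open import Data.Product using (∃-syntax; _×_; _,_; proj₁; proj₂)
open import Data.Sum using (_⊎_; inj₁; inj₂)
open import Data.Vec.Base using ([]; _∷_; here; there)
open import Function using (_∘_)
open import Level using (Level)
open import Relation.Nullary using (¬_; Dec; yes; no; contradiction)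
open import Relation.Nullary.Decidable using (decidable-stable; ¬¬-excluded-middle; _×-dec_)
open import Relation.Nullary.Negation using (DoubleNegation)
open import Relation.Unary using (Pred; Decidable)
open import Relation.Binary.PropositionalEquality using (_≡_; refl; sym; trans; cong; cong₂; subst)

private
  variable
    p : Level
    m : ℕ

module ℕ-Sum = CommutativeMonoidSum +-0-commutativeMonoid

total-cong : {f g : Fin m → ℕ} → (∀ i → f i ≡ g i) → total f ≡ total g
total-cong {zero}  f≡g = refl
total-cong {suc m} f≡g = cong₂ _+_ (f≡g zero) (total-cong (f≡g ∘ suc))

total-mono : {f g : Fin m → ℕ} → (∀ i → f i ≤ g i) → total f ≤ total g
total-mono {zero}  f≤g = z≤n
total-mono {suc m} f≤g = +-mono-≤ (f≤g zero) (total-mono (f≤g ∘ suc))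

total-zero : {f : Fin m → ℕ} → (∀ i → f i ≡ 0) → total f ≡ 0
total-zero {zero}  f≡0 = refl
total-zero {suc m} f≡0 = cong₂ _+_ (f≡0 zero) (total-zero (f≡0 ∘ suc))

term≤total : (f : Fin m → ℕ) (i : Fin m) → f i ≤ total f
term≤total f zero    = m≤m+n (f zero) _
term≤total f (suc i) = ≤-trans (term≤total (f ∘ suc) i) (m≤n+m _ (f zero))

total≡sum : (f : Fin m → ℕ) → total f ≡ ℕ-Sum.sum f
total≡sum {zero}  f = refl
total≡sum {suc m} f = cong (f zero +_) (total≡sum (f ∘ suc))

total-comm : ∀ {k} (F : Fin m → Fin k → ℕ) →
  total (λ i → total (F i)) ≡ total (λ j → total (λ i → F i j))
total-comm F = begin
  total (λ i → total (F i))          ≡⟨ total≡sum (λ i → total (F i)) ⟩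
  sum (λ i → total (F i))            ≡⟨ sum-cong-≗ (λ i → total≡sum (F i)) ⟩
  sum (λ i → sum (F i))              ≡⟨ ∑-comm F ⟩
  sum (λ j → sum (λ i → F i j))      ≡⟨ sum-cong-≗ (λ j → total≡sum (λ i → F i j)) ⟨
  sum (λ j → total (λ i → F i j))    ≡⟨ total≡sum (λ j → total (λ i → F i j)) ⟨
  total (λ j → total (λ i → F i j))  ∎
  where
  open ℕ-Sum using (sum; sum-cong-≗; ∑-comm)
  open Relation.Binary.PropositionalEquality.≡-Reasoning

total-++ : ∀ a {b} (F : Fin (a + b) → ℕ) →
  total F ≡ total (λ i → F (i ↑ˡ b)) + total (λ j → F (a ↑ʳ j))
total-++ zero    F = refl
total-++ (suc a) F = trans (cong (F zero +_) (total-++ a (F ∘ suc))) (sym (+-assoc (F zero) _ _))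

total-combine : ∀ m {k} (F : Fin (m * k) → ℕ) →
  total F ≡ total (λ g → total (λ h → F (combine {m} {k} g h)))
total-combine zero    F = refl
total-combine (suc m) {k} F =
  trans (total-++ k F) (cong (total (λ h → F (h ↑ˡ (m * k))) +_) (total-combine m (F ∘ (k ↑ʳ_))))

∣S∣*c≤total : (S : Subset m) {c : ℕ} {X : Fin m → ℕ} → (∀ {u} → u ∈ S → c ≤ X u) → ∣ S ∣ * c ≤ total X
∣S∣*c≤total []            c≤X = z≤n
∣S∣*c≤total (inside ∷ S)  c≤X = +-mono-≤ (c≤X here) (∣S∣*c≤total S (c≤X ∘ there))
∣S∣*c≤total (outside ∷ S) c≤X = ≤-trans (∣S∣*c≤total S (c≤X ∘ there)) (m≤n+m _ _)

infix 5 _if_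

_if_ : {P : Set p} → ℕ → Dec P → ℕ
x if yes _ = x
x if no  _ = 0

if-holds : {P : Set p} (x : ℕ) (P? : Dec P) → P → x if P? ≡ x
if-holds x (yes _) _  = refl
if-holds x (no ¬P) pf = contradiction pf ¬P

if-fails : {P : Set p} (x : ℕ) (P? : Dec P) → ¬ P → x if P? ≡ 0
if-fails x (yes pf) ¬P = contradiction pf ¬P
if-fails x (no _)   _  = refl

total-if-unique : {P : Pred (Fin m) p} (P? : Decidable P) (x : ℕ) →
  (∀ {i j} → P i → P j → i ≡ j) → total (λ i → x if P? i) ≤ x
total-if-unique {zero}  P? x unique = z≤n
total-if-unique {suc m} P? x unique with P? zero
... | no _    = total-if-unique (P? ∘ suc) x (λ Pi Pj → suc-injective (unique Pi Pj))
... | yes P₀ = ≤-reflexive (trans (cong (x +_) rest≡0) (+-identityʳ x))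
  where
  rest≡0 : total (λ i → x if P? (suc i)) ≡ 0
  rest≡0 = total-zero (λ i → if-fails x (P? (suc i)) (λ Pi → contradiction (unique Pi P₀) λ ()))

¬¬-∀-Fin : {P : Pred (Fin m) p} → (∀ i → DoubleNegation (P i)) → DoubleNegation (∀ i → P i)
¬¬-∀-Fin {zero}  ¬¬P k = k λ ()
¬¬-∀-Fin {suc m} ¬¬P k = ¬¬P zero λ P₀ → ¬¬-∀-Fin (¬¬P ∘ suc) λ P₊ → k (∀-cons P₀ P₊)

clamp : ℕ → Fin 3
clamp 0             = zero
clamp 1             = suc zero
clamp (suc (suc _)) = suc (suc zero)

toℕ-clamp≤ : ∀ x → toℕ (clamp x) ≤ x
toℕ-clamp≤ 0             = z≤n
toℕ-clamp≤ 1             = s≤s z≤n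
toℕ-clamp≤ (suc (suc x)) = s≤s (s≤s z≤n)

clamp≡0⇒≡0 : ∀ {x} → toℕ (clamp x) ≡ 0 → x ≡ 0
clamp≡0⇒≡0 {0}           _  = refl
clamp≡0⇒≡0 {1}           ()
clamp≡0⇒≡0 {suc (suc _)} ()

2≤⇒clamp≡2 : ∀ {x} → 2 ≤ x → toℕ (clamp x) ≡ 2
2≤⇒clamp≡2 (s≤s (s≤s _)) = refl

≡⊎Adj⇒closedNbhd : (K : Graph) {a b : Fin (n K)} → a ≡ b ⊎ Adj K a b → InClosedNbhd K a b
≡⊎Adj⇒closedNbhd K (inj₁ a≡b) = inj₁ (sym a≡b)
≡⊎Adj⇒closedNbhd K (inj₂ a~b) = inj₂ a~b

module _ (G H : Graph) where

  strongAdj⇒closedNbhd : ∀ g h y → StrongAdj G H (combine g h) y →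
    InClosedNbhd G g (proj₁ (remQuot {n G} (n H) y)) × InClosedNbhd H h (proj₂ (remQuot {n G} (n H) y))
  strongAdj⇒closedNbhd g h y adj =
    subst (λ (g₀ , h₀) → InClosedNbhd G g₀ g' × InClosedNbhd H h₀ h')
          (remQuot-combine {n G} {n H} g h) (components (combine g h) y adj)
    where
    g' = proj₁ (remQuot {n G} (n H) y)
    h' = proj₂ (remQuot {n G} (n H) y)
    components : ∀ x y → StrongAdj G H x y →
      let (g , h) = remQuot {n G} (n H) x ; (g' , h') = remQuot {n G} (n H) y
      in InClosedNbhd G g g' × InClosedNbhd H h h'
    components x y adj with remQuot {n G} (n H) x | remQuot {n G} (n H) y
    ... | g , h | g' , h' with adj
    ... | _ , g≃g' , h≃h' = ≡⊎Adj⇒closedNbhd G g≃g' , ≡⊎Adj⇒closedNbhd H h≃h'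

  module Projection (F : Fin (n G * n H) → Fin 3) where

    value : Fin (n G) → Fin (n H) → ℕ
    value g h = toℕ (F (combine g h))

    columnSum : {C : Pred (Fin (n G)) p} → Decidable C → Fin (n H) → ℕ
    columnSum C? h = total (λ g → value g h if C? g)

    project : {C : Pred (Fin (n G)) p} → Decidable C → Fin (n H) → Fin 3
    project C? = clamp ∘ columnSum C?

    value≤columnSum : {C : Pred (Fin (n G)) p} (C? : Decidable C) →
      ∀ {g} h → C g → value g h ≤ columnSum C? h
    value≤columnSum C? {g} h Cg =
      subst (_≤ columnSum C? h) (if-holds (value g h) (C? g) Cg) (term≤total (λ g → value g h if C? g) g)

    weight-project : {C : Pred (Fin (n G)) p} (C? : Decidable C) →
      weight H (project C?) ≤ total (columnSum C?)
    weight-project C? = total-mono (toℕ-clamp≤ ∘ columnSum C?)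

    project-isRomanDominating : IsRomanDominating (G ⊠ H) F →
      {C : Pred (Fin (n G)) p} (C? : Decidable C) →
      ∀ {u} → (∀ {g} → InClosedNbhd G u g → C g) → IsRomanDominating H (project C?)
    project-isRomanDominating F-rd C? {u} N[u]⊆C h column≡0 =
      fromNeighbour (F-rd (combine u h) (n≤0⇒n≡0 value≤0))
      where
      value≤0 : value u h ≤ 0
      value≤0 = subst (value u h ≤_) (clamp≡0⇒≡0 column≡0) (value≤columnSum C? h (N[u]⊆C (inj₁ refl)))

      fromNeighbour : ∃[ y ] (StrongAdj G H (combine u h) y × toℕ (F y) ≡ 2) →
        ∃[ h' ] (Adj H h h' × toℕ (project C? h') ≡ 2)
      fromNeighbour (y , adj , Fy≡2) with strongAdj⇒closedNbhd u h y adj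
      ... | g'∈N[u] , h'∈N[h] = neighbour h'∈N[h]
        where
        g' = proj₁ (remQuot {n G} (n H) y)
        h' = proj₂ (remQuot {n G} (n H) y)

        2≤column : 2 ≤ columnSum C? h'
        2≤column = subst (_≤ columnSum C? h') (trans (cong (toℕ ∘ F) (combine-remQuot {n G} (n H) y)) Fy≡2)
                         (value≤columnSum C? h' (N[u]⊆C g'∈N[u]))

        neighbour : InClosedNbhd H h h' → ∃[ h' ] (Adj H h h' × toℕ (project C? h') ≡ 2)
        neighbour (inj₁ h'≡h) = contradiction
          (subst (2 ≤_) (clamp≡0⇒≡0 column≡0) (subst (λ k → 2 ≤ columnSum C? k) h'≡h 2≤column)) λ ()
        neighbour (inj₂ h~h') = h' , h~h' , 2≤⇒clamp≡2 2≤column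

    columnSums≤weight : {Cell : Fin (n G) → Pred (Fin (n G)) p} (Cell? : ∀ u → Decidable (Cell u)) →
      (∀ {u v g} → Cell u g → Cell v g → u ≡ v) →
      total (λ u → total (columnSum (Cell? u))) ≤ weight (G ⊠ H) F
    columnSums≤weight Cell? disjoint = begin
      total (λ u → total (λ h → total (λ g → value g h if Cell? u g)))
        ≡⟨ total-cong (λ u → total-comm (λ h g → value g h if Cell? u g)) ⟩
      total (λ u → total (λ g → total (λ h → value g h if Cell? u g)))
        ≡⟨ total-comm (λ u g → total (λ h → value g h if Cell? u g)) ⟩
      total (λ g → total (λ u → total (λ h → value g h if Cell? u g)))
        ≡⟨ total-cong (λ g → total-comm (λ u h → value g h if Cell? u g)) ⟩
      total (λ g → total (λ h → total (λ u → value g h if Cell? u g)))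
        ≤⟨ total-mono (λ g → total-mono (λ h → total-if-unique (λ u → Cell? u g) (value g h) disjoint)) ⟩
      total (λ g → total (λ h → value g h))
        ≡⟨ total-combine (n G) (toℕ ∘ F) ⟨
      weight (G ⊠ H) F
        ∎
      where open ≤-Reasoning

  packing-bound : (S : Subset (n G)) →
    (∀ u v → u ∈ S → v ∈ S → ¬ u ≡ v → ∀ w → InClosedNbhd G u w → ¬ InClosedNbhd G v w) →
    (∀ u g → Dec (InClosedNbhd G u g)) →
    ∀ {c} → (∀ f → IsRomanDominating H f → c ≤ weight H f) →
    ∀ F → IsRomanDominating (G ⊠ H) F → ∣ S ∣ * c ≤ weight (G ⊠ H) F
  packing-bound S S-packing N? {c} c≤weight F F-rd = begin
    ∣ S ∣ * c
      ≤⟨ ∣S∣*c≤total S (λ u∈S → c≤weight _ (project-isRomanDominating F-rd (Cell? _) (u∈S ,_))) ⟩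
    total (λ u → weight H (project (Cell? u)))
      ≤⟨ total-mono (λ u → weight-project (Cell? u)) ⟩
    total (λ u → total (columnSum (Cell? u)))
      ≤⟨ columnSums≤weight Cell? disjoint ⟩
    weight (G ⊠ H) F
      ∎
    where
    open Projection F
    open ≤-Reasoning

    Cell : Fin (n G) → Pred (Fin (n G)) _
    Cell u g = u ∈ S × InClosedNbhd G u g

    Cell? : ∀ u → Decidable (Cell u)
    Cell? u g = (u ∈? S) ×-dec N? u g

    disjoint : ∀ {u v g} → Cell u g → Cell v g → u ≡ v
    disjoint {u} {v} {g} (u∈S , g∈N[u]) (v∈S , g∈N[v]) =
      decidable-stable (u ≟ v) λ u≢v → S-packing u v u∈S v∈S u≢v g g∈N[u] g∈N[v]

theorem26 : (G H : Graph) → InF G →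
    ∀ {γG γRH γRGH : ℕ} →
    IsDominationNumber G γG →
    IsRomanDominationNumber H γRH →
    IsRomanDominationNumber (G ⊠ H) γRGH →
    γG * γRH ≤ γRGH
theorem26 G H (S , S-dominating , _ , S-packing) {γG} {γRH} {γRGH}
          (_ , γ-minimal) (_ , γR-minimal) ((F , F-rd , F-weight) , _) =
  -- Adjacency need not be decidable, but the goal is, so decidability of
  -- closed neighbourhoods may be assumed under a double negation.
  decidable-stable (γG * γRH ≤? γRGH) λ ≰ →
    ¬¬-∀-Fin (λ u → ¬¬-∀-Fin (λ g → ¬¬-excluded-middle)) λ N? → ≰ (begin
      γG * γRH          ≤⟨ *-monoˡ-≤ γRH (γ-minimal S S-dominating) ⟩
      ∣ S ∣ * γRH       ≤⟨ packing-bound G H S S-packing N? γR-minimal F F-rd ⟩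
      weight (G ⊠ H) F  ≡⟨ F-weight ⟩
      γRGH              ∎)
  where open ≤-Reasoning
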